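{- Let $m,n$ be integers with $m\ge n\ge0$ and let $f_n(x)\in\mathbb{C}[x]$ be any polynomial of degree $n$. Then for all $k\in\mathbb{Z}\setminus\{ -m,\ldots,-1,0\}$, \[f_n(x+k)=k\binom{m+k}{m}\sum_{j=0}^m(-1)^j\frac{1}{k+j}\binom mj f_n(x-j).\]
   Context: For integers $N$ and $m\ge0$, $\binom Nm=N(N-1)\cdots(N-m+1)/m!$. -}

module Defs where

open import Level using (Level; _⊔_) renaming (suc to lsuc)
open import Algebra.Bundles using (CommutativeRing)
open import Data.Nat as ℕ using (ℕ; zero; suc)
open import Data.Fin using (Fin; toℕ; fromℕ)
import Data.Fin as Fin
open import Data.Integer as ℤ using (ℤ; +_; -[1+_])
open import Relation.Nullary using (¬_)

module RingOps {c ℓ : Level} (R : CommutativeRing c ℓ) where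
  open CommutativeRing R

  fromℕ' : ℕ → Carrier
  fromℕ' zero    = 0#
  fromℕ' (suc n) = 1# + fromℕ' n

  fromℤ : ℤ → Carrier
  fromℤ (+ n)      = fromℕ' n
  fromℤ -[1+ n ]   = - fromℕ' (suc n)

  pow : Carrier → ℕ → Carrier
  pow x zero    = 1#
  pow x (suc i) = x * pow x i

  sumFin : (n : ℕ) → (Fin n → Carrier) → Carrier
  sumFin zero    g = 0#
  sumFin (suc n) g = g Fin.zero + sumFin n (λ i → g (Fin.suc i))

  prodFin : (n : ℕ) → (Fin n → Carrier) → Carrier
  prodFin zero    g = 1#
  prodFin (suc n) g = g Fin.zero * prodFin n (λ i → g (Fin.suc i))

  falling : ℤ → ℕ → Carrier
  falling N m = prodFin m (λ i → fromℤ (N ℤ.- + toℕ i))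

  evalPoly : (n : ℕ) → (Fin (suc n) → Carrier) → Carrier → Carrier
  evalPoly n a x = sumFin (suc n) (λ i → a i * pow x (toℕ i))

-- A field of characteristic zero, with a total inverse operation
-- (x⁻¹ is only constrained for x ≉ 0).
record CharZeroField (c ℓ : Level) : Set (lsuc (c ⊔ ℓ)) where
  field
    commutativeRing : CommutativeRing c ℓ
  open CommutativeRing commutativeRing public
  open RingOps commutativeRing public
  field
    _⁻¹      : Carrier → Carrier
    inverse  : ∀ x → ¬ (x ≈ 0#) → x * (x ⁻¹) ≈ 1#
    charZero : ∀ n → ¬ (fromℕ' (suc n) ≈ 0#)

  binom : ℤ → ℕ → Carrier
  binom N m = falling N m * (fromℕ' (m ℕ.!) ⁻¹)

module Submission where

-- Write Δ m u = Σ_{j ≤ m} (-1)ʲ C(m,j) u(j). Pascal's rule gives Δ (m+1) u = Δ m u - Δ m (u ∘ suc),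
-- and the absorption identity j C(m+1,j) = (m+1) C(m,j-1) turns Δ (m+1) (j ↦ j u(j)) into
-- -(m+1) Δ m (u ∘ suc). Together they show that Δ m annihilates polynomials in j of degree < m,
-- and, by induction on m, the partial fraction identity K (K+1) ⋯ (K+m) · Δ m (j ↦ 1/(K+j)) = m!.
-- Writing x - j = (x + K) - (K + j), induction on i then gives
-- K (K+1) ⋯ (K+m) · Δ m (j ↦ (x-j)ⁱ/(K+j)) = m! (x+K)ⁱ for i ≤ m, the term in which K + j cancels
-- dropping out because its Δ vanishes. Linearity extends this to polynomials of degree ≤ m, and
-- dividing by m! gives the identity at K = k.

open import Defs
open import Level using (Level)
open import Algebra.Bundles using (CommutativeRing)
import Algebra.Solver.Ring
import Algebra.Solver.Ring.AlmostCommutativeRing as ACR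
open import Data.Fin as Fin using (Fin; toℕ; fromℕ)
import Data.Fin.Properties as Fin
open import Data.Integer as ℤ using (ℤ; +_; -[1+_])
import Data.Integer.Properties as ℤ
open import Data.Maybe using (Maybe; just; nothing)
open import Data.Nat as ℕ using (ℕ; zero; suc; _≤_; _!)
import Data.Nat.Properties as ℕ
open import Data.Nat.Combinatorics using (_C_; k>n⇒nCk≡0; nC1≡n; nCk+nC[k+1]≡[n+1]C[k+1])
open import Data.Product using (_×_; _,_)
open import Relation.Binary.PropositionalEquality as ≡ using (_≡_)
import Relation.Binary.Reasoning.Setoid as ≈-Reasoning
open import Relation.Nullary using (¬_; yes; no; contradiction)
open import Function using (_∘_)

[k+1]*[n+1]C[k+1]≡[n+1]*nCk : ∀ n k → suc k ℕ.* (suc n C suc k) ≡ suc n ℕ.* (n C k)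
[k+1]*[n+1]C[k+1]≡[n+1]*nCk n       zero    =
  ≡.trans (ℕ.+-identityʳ _) (≡.trans (nC1≡n (suc n)) (≡.sym (ℕ.*-identityʳ _)))
[k+1]*[n+1]C[k+1]≡[n+1]*nCk zero    (suc k) = ℕ.*-zeroʳ (suc (suc k))
[k+1]*[n+1]C[k+1]≡[n+1]*nCk (suc n) (suc k) = begin
  suc (suc k) ℕ.* (suc (suc n) C suc (suc k))
    ≡⟨ ≡.cong (suc (suc k) ℕ.*_) (nCk+nC[k+1]≡[n+1]C[k+1] (suc n) (suc k)) ⟨
  suc (suc k) ℕ.* (N C suc k ℕ.+ N C suc (suc k))
    ≡⟨ ℕ.*-distribˡ-+ (suc (suc k)) (N C suc k) _ ⟩
  (N C suc k ℕ.+ suc k ℕ.* (N C suc k)) ℕ.+ suc (suc k) ℕ.* (N C suc (suc k))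
    ≡⟨ ≡.cong₂ (λ a b → (N C suc k ℕ.+ a) ℕ.+ b) ([k+1]*[n+1]C[k+1]≡[n+1]*nCk n k)
                                                 ([k+1]*[n+1]C[k+1]≡[n+1]*nCk n (suc k)) ⟩
  (N C suc k ℕ.+ N ℕ.* (n C k)) ℕ.+ N ℕ.* (n C suc k)
    ≡⟨ ℕ.+-assoc (N C suc k) _ _ ⟩
  N C suc k ℕ.+ (N ℕ.* (n C k) ℕ.+ N ℕ.* (n C suc k))
    ≡⟨ ≡.cong (N C suc k ℕ.+_) (ℕ.*-distribˡ-+ N (n C k) _) ⟨
  N C suc k ℕ.+ N ℕ.* (n C k ℕ.+ n C suc k)
    ≡⟨ ≡.cong (λ t → N C suc k ℕ.+ N ℕ.* t) (nCk+nC[k+1]≡[n+1]C[k+1] n k) ⟩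
  suc N ℕ.* (N C suc k) ∎
  where
  open ≡.≡-Reasoning
  N = suc n

module CommutativeRingProperties {c ℓ : Level} (R : CommutativeRing c ℓ) where
  open CommutativeRing R
  open RingOps R
  open ≈-Reasoning setoid
  open import Algebra.Properties.Ring ring
    using (-‿involutive; -0#≈0#; -‿distribˡ-*; -‿distribʳ-*; -‿+-comm)
  open import Algebra.Properties.CommutativeSemigroup +-commutativeSemigroup using (interchange)
  open import Algebra.Properties.CommutativeSemigroup *-commutativeSemigroup using (x∙yz≈y∙xz)
  open import Algebra.Definitions.RawMonoid +-rawMonoid using () renaming (_×_ to _×ᵣ_)
  open import Algebra.Properties.Monoid.Mult +-monoid using (×-homo-+)
  open import Algebra.Properties.Semiring.Mult semiring using (×1-homo-*)
  open import Algebra.Properties.Semiring.Sum semiring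
    using ( sum; sum-syntax; sum⁺-syntax; sum-cong-≋; sum-cong-≗; sum-init-last
          ; ∑-distrib-+; ∑-comm; *-distribˡ-sum )

  fromℕ'≡×1# : ∀ n → fromℕ' n ≡ n ×ᵣ 1#
  fromℕ'≡×1# zero    = ≡.refl
  fromℕ'≡×1# (suc n) = ≡.cong (_+_ 1#) (fromℕ'≡×1# n)

  fromℕ'-homo-+ : ∀ m n → fromℕ' (m ℕ.+ n) ≈ fromℕ' m + fromℕ' n
  fromℕ'-homo-+ m n
    rewrite fromℕ'≡×1# m | fromℕ'≡×1# n | fromℕ'≡×1# (m ℕ.+ n) = ×-homo-+ 1# m n

  fromℕ'-homo-* : ∀ m n → fromℕ' (m ℕ.* n) ≈ fromℕ' m * fromℕ' n
  fromℕ'-homo-* m n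
    rewrite fromℕ'≡×1# m | fromℕ'≡×1# n | fromℕ'≡×1# (m ℕ.* n) = ×1-homo-* m n

  fromℤ-homo-- : ∀ z → fromℤ (ℤ.- z) ≈ - fromℤ z
  fromℤ-homo-- (+ zero)  = sym -0#≈0#
  fromℤ-homo-- (+ suc n) = refl
  fromℤ-homo-- -[1+ n ]  = sym (-‿involutive _)

  fromℤ-homo-⊖ : ∀ m n → fromℤ (m ℤ.⊖ n) ≈ fromℕ' m - fromℕ' n
  fromℤ-homo-⊖ zero    zero    = sym (-‿inverseʳ 0#)
  fromℤ-homo-⊖ zero    (suc n) = sym (+-identityˡ _)
  fromℤ-homo-⊖ (suc m) zero    = trans (sym (+-identityʳ _)) (+-congˡ (sym -0#≈0#))
  fromℤ-homo-⊖ (suc m) (suc n) = begin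
    fromℤ (suc m ℤ.⊖ suc n)                  ≡⟨ ≡.cong fromℤ (ℤ.[1+m]⊖[1+n]≡m⊖n m n) ⟩
    fromℤ (m ℤ.⊖ n)                          ≈⟨ fromℤ-homo-⊖ m n ⟩
    fromℕ' m - fromℕ' n                      ≈⟨ +-identityˡ _ ⟨
    0# + (fromℕ' m - fromℕ' n)               ≈⟨ +-congʳ (-‿inverseʳ 1#) ⟨
    (1# - 1#) + (fromℕ' m - fromℕ' n)        ≈⟨ interchange 1# (- 1#) (fromℕ' m) (- fromℕ' n) ⟩
    (1# + fromℕ' m) + (- 1# - fromℕ' n)      ≈⟨ +-congˡ (-‿+-comm 1# (fromℕ' n)) ⟩
    (1# + fromℕ' m) - (1# + fromℕ' n)        ∎

  fromℤ-homo-+ : ∀ a b → fromℤ (a ℤ.+ b) ≈ fromℤ a + fromℤ b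
  fromℤ-homo-+ (+ m)    (+ n)    = fromℕ'-homo-+ m n
  fromℤ-homo-+ (+ m)    -[1+ n ] = fromℤ-homo-⊖ m (suc n)
  fromℤ-homo-+ -[1+ m ] (+ n)    = trans (fromℤ-homo-⊖ n (suc m)) (+-comm _ _)
  fromℤ-homo-+ -[1+ m ] -[1+ n ] = begin
    - fromℕ' (suc (suc m ℕ.+ n))                ≡⟨ ≡.cong (λ t → - fromℕ' (suc t)) (ℕ.+-suc m n) ⟨
    - fromℕ' (suc m ℕ.+ suc n)                  ≈⟨ -‿cong (fromℕ'-homo-+ (suc m) (suc n)) ⟩
    - (fromℕ' (suc m) + fromℕ' (suc n))         ≈⟨ -‿+-comm _ _ ⟨
    - fromℕ' (suc m) + - fromℕ' (suc n)         ∎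

  fromℤ-homo-*ᵖ : ∀ m b → fromℤ (+ m ℤ.* b) ≈ fromℕ' m * fromℤ b
  fromℤ-homo-*ᵖ m (+ n) = begin
    fromℤ (+ m ℤ.* + n)  ≡⟨ ≡.cong fromℤ (ℤ.pos-* m n) ⟨
    fromℕ' (m ℕ.* n)    ≈⟨ fromℕ'-homo-* m n ⟩
    fromℕ' m * fromℕ' n ∎
  fromℤ-homo-*ᵖ m -[1+ n ] = begin
    fromℤ (+ m ℤ.* ℤ.- + suc n)    ≡⟨ ≡.cong fromℤ (ℤ.neg-distribʳ-* (+ m) (+ suc n)) ⟨
    fromℤ (ℤ.- (+ m ℤ.* + suc n))  ≈⟨ fromℤ-homo-- (+ m ℤ.* + suc n) ⟩
    - fromℤ (+ m ℤ.* + suc n)      ≈⟨ -‿cong (fromℤ-homo-*ᵖ m (+ suc n)) ⟩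
    - (fromℕ' m * fromℕ' (suc n))  ≈⟨ -‿distribʳ-* _ _ ⟩
    fromℕ' m * - fromℕ' (suc n)    ∎

  fromℤ-homo-* : ∀ a b → fromℤ (a ℤ.* b) ≈ fromℤ a * fromℤ b
  fromℤ-homo-* (+ m)    b = fromℤ-homo-*ᵖ m b
  fromℤ-homo-* -[1+ m ] b = begin
    fromℤ (ℤ.- + suc m ℤ.* b)       ≡⟨ ≡.cong fromℤ (ℤ.neg-distribˡ-* (+ suc m) b) ⟨
    fromℤ (ℤ.- (+ suc m ℤ.* b))     ≈⟨ fromℤ-homo-- (+ suc m ℤ.* b) ⟩
    - fromℤ (+ suc m ℤ.* b)         ≈⟨ -‿cong (fromℤ-homo-*ᵖ (suc m) b) ⟩
    - (fromℕ' (suc m) * fromℤ b)    ≈⟨ -‿distribˡ-* _ _ ⟩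
    - fromℕ' (suc m) * fromℤ b      ∎

  -- fromℤ, except that 0, 1 and -1 go to 0#, 1# and - 1# on the nose, so that
  -- solver constants match the goals syntactically.
  ⟦_⟧ℤ : ℤ → Carrier
  ⟦ + zero       ⟧ℤ = 0#
  ⟦ + suc zero   ⟧ℤ = 1#
  ⟦ -[1+ zero ]  ⟧ℤ = - 1#
  ⟦ z            ⟧ℤ = fromℤ z

  ⟦⟧ℤ≈fromℤ : ∀ z → ⟦ z ⟧ℤ ≈ fromℤ z
  ⟦⟧ℤ≈fromℤ (+ zero)        = refl
  ⟦⟧ℤ≈fromℤ (+ suc zero)    = sym (+-identityʳ 1#)
  ⟦⟧ℤ≈fromℤ (+ suc (suc n)) = refl
  ⟦⟧ℤ≈fromℤ -[1+ zero ]     = -‿cong (sym (+-identityʳ 1#))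
  ⟦⟧ℤ≈fromℤ -[1+ suc n ]    = refl

  private
    almostCommutativeRing : ACR.AlmostCommutativeRing c ℓ
    almostCommutativeRing = ACR.fromCommutativeRing R

    ℤ-coefficients : ℤ.+-*-rawRing ACR.-Raw-AlmostCommutative⟶ almostCommutativeRing
    ℤ-coefficients = record
      { ⟦_⟧    = ⟦_⟧ℤ
      ; +-homo = λ a b → transported (a ℤ.+ b) (fromℤ-homo-+ a b) (+-cong (⟦⟧ℤ≈fromℤ a) (⟦⟧ℤ≈fromℤ b))
      ; *-homo = λ a b → transported (a ℤ.* b) (fromℤ-homo-* a b) (*-cong (⟦⟧ℤ≈fromℤ a) (⟦⟧ℤ≈fromℤ b))
      ; -‿homo = λ a   → transported (ℤ.- a)   (fromℤ-homo-- a)   (-‿cong (⟦⟧ℤ≈fromℤ a))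
      ; 0-homo = refl
      ; 1-homo = refl
      }
      where
      transported : ∀ z {x y} → fromℤ z ≈ x → y ≈ x → ⟦ z ⟧ℤ ≈ y
      transported z p q = trans (⟦⟧ℤ≈fromℤ z) (trans p (sym q))

    ℤ-coefficient-equality : ∀ a b → Maybe (⟦ a ⟧ℤ ≈ ⟦ b ⟧ℤ)
    ℤ-coefficient-equality a b with a ℤ.≟ b
    ... | yes ≡.refl = just refl
    ... | no _       = nothing

  module ℤ-CoefficientSolver =
    Algebra.Solver.Ring ℤ.+-*-rawRing almostCommutativeRing ℤ-coefficients ℤ-coefficient-equality
  open ℤ-CoefficientSolver using (solve; _:+_; _:*_; _:-_; :-_; _:=_; con)

  pow-congˡ : ∀ {x y} i → x ≈ y → pow x i ≈ pow y i
  pow-congˡ zero    x≈y = refl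
  pow-congˡ (suc i) x≈y = *-cong x≈y (pow-congˡ i x≈y)

  sumFin≡sum : ∀ n (f : Fin n → Carrier) → sumFin n f ≡ sum f
  sumFin≡sum zero    f = ≡.refl
  sumFin≡sum (suc n) f = ≡.cong (_+_ (f Fin.zero)) (sumFin≡sum n (λ i → f (Fin.suc i)))

  ∑-cong : ∀ n {f g : Fin n → Carrier} → (∀ i → f i ≈ g i) → ∑[ i < n ] f i ≈ ∑[ i < n ] g i
  ∑-cong n = sum-cong-≋

  ∑-linear : ∀ n a b (f g : Fin n → Carrier) →
             ∑[ i < n ] (a * f i + b * g i) ≈ a * sum f + b * sum g
  ∑-linear n a b f g = begin
    ∑[ i < n ] (a * f i + b * g i)              ≈⟨ ∑-distrib-+ (λ i → a * f i) (λ i → b * g i) ⟩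
    ∑[ i < n ] (a * f i) + ∑[ i < n ] (b * g i) ≈⟨ +-cong (*-distribˡ-sum a f) (*-distribˡ-sum b g) ⟨
    a * sum f + b * sum g                        ∎

  ∑-toℕ-init-last : ∀ n (f : ℕ → Carrier) →
                    ∑[ j ≤ suc n ] f (toℕ j) ≈ ∑[ j ≤ n ] f (toℕ j) + f (suc n)
  ∑-toℕ-init-last n f = begin
    ∑[ j ≤ suc n ] f (toℕ j)
      ≈⟨ sum-init-last (λ j → f (toℕ j)) ⟩
    ∑[ j ≤ n ] f (toℕ (Fin.inject₁ j)) + f (toℕ (fromℕ (suc n)))
      ≡⟨ ≡.cong₂ _+_ (sum-cong-≗ {suc n} (λ j → ≡.cong f (Fin.toℕ-inject₁ j)))
                     (≡.cong f (Fin.toℕ-fromℕ (suc n))) ⟩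
    ∑[ j ≤ n ] f (toℕ j) + f (suc n)
      ∎

  C-absorption : ∀ m j → fromℕ' (suc m C suc j) * fromℕ' (suc j) ≈ fromℕ' (suc m) * fromℕ' (m C j)
  C-absorption m j = begin
    fromℕ' (suc m C suc j) * fromℕ' (suc j)  ≈⟨ *-comm _ _ ⟩
    fromℕ' (suc j) * fromℕ' (suc m C suc j)  ≈⟨ fromℕ'-homo-* (suc j) (suc m C suc j) ⟨
    fromℕ' (suc j ℕ.* (suc m C suc j))       ≡⟨ ≡.cong fromℕ' ([k+1]*[n+1]C[k+1]≡[n+1]*nCk m j) ⟩
    fromℕ' (suc m ℕ.* (m C j))               ≈⟨ fromℕ'-homo-* (suc m) (m C j) ⟩
    fromℕ' (suc m) * fromℕ' (m C j)          ∎

  fall : Carrier → ℕ → Carrier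
  fall y zero    = 1#
  fall y (suc j) = y * fall (y - 1#) j

  fall-congˡ : ∀ {x y} j → x ≈ y → fall x j ≈ fall y j
  fall-congˡ zero    x≈y = refl
  fall-congˡ (suc j) x≈y = *-cong x≈y (fall-congˡ j (+-congʳ x≈y))

  fall-suc-last : ∀ y j → fall y (suc j) ≈ fall y j * (y - fromℕ' j)
  fall-suc-last y zero    = solve 1 (λ y → y :* con (+ 1) := con (+ 1) :* (y :- con (+ 0))) refl y
  fall-suc-last y (suc j) = begin
    y * fall (y - 1#) (suc j)                     ≈⟨ *-congˡ (fall-suc-last (y - 1#) j) ⟩
    y * (fall (y - 1#) j * ((y - 1#) - fromℕ' j))
      ≈⟨ solve 3 (λ y f J → y :* (f :* ((y :- con (+ 1)) :- J)) := (y :* f) :* (y :- (con (+ 1) :+ J)))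
                 refl y _ (fromℕ' j) ⟩
    y * fall (y - 1#) j * (y - fromℕ' (suc j))    ∎

  C-falling : ∀ m j → fromℕ' (m C j) * fromℕ' (j !) ≈ fall (fromℕ' m) j
  C-falling m       zero    =
    solve 0 ((con (+ 1) :+ con (+ 0)) :* (con (+ 1) :+ con (+ 0)) := con (+ 1)) refl
  C-falling zero    (suc j) = trans (zeroˡ _) (sym (zeroˡ _))
  C-falling (suc m) (suc j) = begin
    fromℕ' (suc m C suc j) * fromℕ' (suc j ℕ.* j !)           ≈⟨ *-congˡ (fromℕ'-homo-* (suc j) (j !)) ⟩
    fromℕ' (suc m C suc j) * (fromℕ' (suc j) * fromℕ' (j !))  ≈⟨ *-assoc _ _ _ ⟨
    fromℕ' (suc m C suc j) * fromℕ' (suc j) * fromℕ' (j !)    ≈⟨ *-congʳ (C-absorption m j) ⟩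
    fromℕ' (suc m) * fromℕ' (m C j) * fromℕ' (j !)            ≈⟨ *-assoc _ _ _ ⟩
    fromℕ' (suc m) * (fromℕ' (m C j) * fromℕ' (j !))          ≈⟨ *-congˡ (C-falling m j) ⟩
    fromℕ' (suc m) * fall (fromℕ' m) j                        ≈⟨ *-congˡ (fall-congˡ j M≈[1+M]-1) ⟩
    fall (fromℕ' (suc m)) (suc j)                             ∎
    where
    M≈[1+M]-1 : fromℕ' m ≈ (1# + fromℕ' m) - 1#
    M≈[1+M]-1 = solve 1 (λ M → M := (con (+ 1) :+ M) :- con (+ 1)) refl (fromℕ' m)

  prodFin-cong : ∀ n {f g : Fin n → Carrier} → (∀ i → f i ≈ g i) → prodFin n f ≈ prodFin n g
  prodFin-cong zero    f≈g = refl
  prodFin-cong (suc n) f≈g = *-cong (f≈g Fin.zero) (prodFin-cong n (λ i → f≈g (Fin.suc i)))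

  prodFin≈fall : ∀ j y → prodFin j (λ i → y - fromℕ' (toℕ i)) ≈ fall y j
  prodFin≈fall zero    y = refl
  prodFin≈fall (suc j) y = *-cong (solve 1 (λ y → y :- con (+ 0) := y) refl y) (begin
    prodFin j (λ i → y - fromℕ' (suc (toℕ i)))
      ≈⟨ prodFin-cong j (λ i → solve 2 (λ y I → y :- (con (+ 1) :+ I) := (y :- con (+ 1)) :- I)
                                       refl y _) ⟩
    prodFin j (λ i → (y - 1#) - fromℕ' (toℕ i))
      ≈⟨ prodFin≈fall j (y - 1#) ⟩
    fall (y - 1#) j
      ∎)

  falling≈fall : ∀ N j → falling N j ≈ fall (fromℤ N) j
  falling≈fall N j = begin
    prodFin j (λ i → fromℤ (N ℤ.- + toℕ i))
      ≈⟨ prodFin-cong j (λ i → fromℤ-homo-+ N (ℤ.- + toℕ i)) ⟩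
    prodFin j (λ i → fromℤ N + fromℤ (ℤ.- + toℕ i))
      ≈⟨ prodFin-cong j (λ i → +-congˡ (fromℤ-homo-- (+ toℕ i))) ⟩
    prodFin j (λ i → fromℤ N - fromℕ' (toℕ i))
      ≈⟨ prodFin≈fall j (fromℤ N) ⟩
    fall (fromℤ N) j
      ∎

  -- Alternating binomial sums

  ±C : ℕ → ℕ → Carrier
  ±C m j = pow (- 1#) j * fromℕ' (m C j)

  -- Δ m u = ((1 - E)ᵐ u)(0) for the shift E u = u ∘ suc, i.e. (-1)ᵐ times the
  -- m-th forward difference of u at 0.
  Δ : ℕ → (ℕ → Carrier) → Carrier
  Δ m u = ∑[ j ≤ m ] (±C m (toℕ j) * u (toℕ j))

  Δ-cong : ∀ m {u v} → (∀ j → j ≤ m → u j ≈ v j) → Δ m u ≈ Δ m v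
  Δ-cong m u≈v = ∑-cong (suc m) (λ j → *-congˡ {±C m (toℕ j)} (u≈v (toℕ j) (Fin.toℕ≤pred[n] j)))

  Δ-scale : ∀ m a (u : ℕ → Carrier) → Δ m (λ j → a * u j) ≈ a * Δ m u
  Δ-scale m a u = begin
    ∑[ j ≤ m ] (±C m (toℕ j) * (a * u (toℕ j)))
      ≈⟨ ∑-cong (suc m) (λ j → x∙yz≈y∙xz (±C m (toℕ j)) a (u (toℕ j))) ⟩
    ∑[ j ≤ m ] (a * (±C m (toℕ j) * u (toℕ j)))
      ≈⟨ *-distribˡ-sum {suc m} a (λ j → ±C m (toℕ j) * u (toℕ j)) ⟨
    a * Δ m u
      ∎

  Δ-linear : ∀ m a b (u v : ℕ → Carrier) → Δ m (λ j → a * u j + b * v j) ≈ a * Δ m u + b * Δ m v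
  Δ-linear m a b u v = begin
    ∑[ j ≤ m ] (±C m (toℕ j) * (a * u (toℕ j) + b * v (toℕ j)))
      ≈⟨ ∑-cong (suc m) (λ j → distribute (±C m (toℕ j)) (u (toℕ j)) (v (toℕ j))) ⟩
    ∑[ j ≤ m ] (a * (±C m (toℕ j) * u (toℕ j)) + b * (±C m (toℕ j) * v (toℕ j)))
      ≈⟨ ∑-linear (suc m) a b (λ j → ±C m (toℕ j) * u (toℕ j))
                              (λ j → ±C m (toℕ j) * v (toℕ j)) ⟩
    a * Δ m u + b * Δ m v
      ∎
    where
    distribute : ∀ c x y → c * (a * x + b * y) ≈ a * (c * x) + b * (c * y)
    distribute =
      solve 5 (λ a b c x y → c :* (a :* x :+ b :* y) := a :* (c :* x) :+ b :* (c :* y)) refl a b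

  Δ-∑ : ∀ m {n} (g : Fin n → ℕ → Carrier) →
        Δ m (λ j → ∑[ i < n ] g i j) ≈ ∑[ i < n ] Δ m (g i)
  Δ-∑ m {n} g = begin
    ∑[ j ≤ m ] (±C m (toℕ j) * ∑[ i < n ] g i (toℕ j))
      ≈⟨ ∑-cong (suc m) (λ j → *-distribˡ-sum (±C m (toℕ j)) (λ i → g i (toℕ j))) ⟩
    ∑[ j ≤ m ] ∑[ i < n ] (±C m (toℕ j) * g i (toℕ j))
      ≈⟨ ∑-comm {suc m} {n} (λ j i → ±C m (toℕ j) * g i (toℕ j)) ⟩
    ∑[ i < n ] Δ m (g i)
      ∎

  Δ-suc : ∀ m (u : ℕ → Carrier) → Δ (suc m) u ≈ Δ m u - Δ m (λ j → u (suc j))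
  Δ-suc m u = begin
    X 0 + ∑[ j ≤ m ] (±C (suc m) (suc (toℕ j)) * u (suc (toℕ j)))
      ≈⟨ +-congˡ (∑-cong (suc m) (λ j → pascal (toℕ j))) ⟩
    X 0 + ∑[ j ≤ m ] (1# * X (suc (toℕ j)) + - 1# * Y (toℕ j))
      ≈⟨ +-congˡ (∑-linear (suc m) 1# (- 1#) (λ j → X (suc (toℕ j))) (λ j → Y (toℕ j))) ⟩
    X 0 + (1# * ∑[ j ≤ m ] X (suc (toℕ j)) + - 1# * Δ m (λ j → u (suc j)))
      ≈⟨ solve 3 (λ a b c → a :+ (con (+ 1) :* b :+ con -[1+ 0 ] :* c) := (a :+ b) :- c) refl _ _ _ ⟩
    ∑[ j ≤ suc m ] X (toℕ j) - Δ m (λ j → u (suc j))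
      ≈⟨ +-congʳ (∑-toℕ-init-last m X) ⟩
    (Δ m u + X (suc m)) - Δ m (λ j → u (suc j))
      ≈⟨ +-congʳ (trans (+-congˡ X[1+m]≈0) (+-identityʳ _)) ⟩
    Δ m u - Δ m (λ j → u (suc j))
      ∎
    where
    X Y : ℕ → Carrier
    X j = ±C m j * u j
    Y j = ±C m j * u (suc j)
    pascal : ∀ j → ±C (suc m) (suc j) * u (suc j) ≈ 1# * X (suc j) + - 1# * Y j
    pascal j = begin
      - 1# * s * fromℕ' (suc m C suc j) * u (suc j)
        ≡⟨ ≡.cong (λ t → - 1# * s * fromℕ' t * u (suc j)) (nCk+nC[k+1]≡[n+1]C[k+1] m j) ⟨
      - 1# * s * fromℕ' (m C j ℕ.+ m C suc j) * u (suc j)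
        ≈⟨ *-congʳ (*-congˡ (fromℕ'-homo-+ (m C j) (m C suc j))) ⟩
      - 1# * s * (fromℕ' (m C j) + fromℕ' (m C suc j)) * u (suc j)
        ≈⟨ solve 4 (λ s c c′ w → con -[1+ 0 ] :* s :* (c :+ c′) :* w
                                   := con (+ 1) :* (con -[1+ 0 ] :* s :* c′ :* w) :+ con -[1+ 0 ] :* (s :* c :* w))
                   refl s (fromℕ' (m C j)) (fromℕ' (m C suc j)) (u (suc j)) ⟩
      1# * X (suc j) + - 1# * Y j
        ∎
      where s = pow (- 1#) j
    X[1+m]≈0 : X (suc m) ≈ 0#
    X[1+m]≈0 = begin
      pow (- 1#) (suc m) * fromℕ' (m C suc m) * u (suc m)
        ≡⟨ ≡.cong (λ t → pow (- 1#) (suc m) * fromℕ' t * u (suc m)) (k>n⇒nCk≡0 (ℕ.n<1+n m)) ⟩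
      pow (- 1#) (suc m) * 0# * u (suc m)
        ≈⟨ solve 2 (λ s w → s :* con (+ 0) :* w := con (+ 0)) refl _ _ ⟩
      0#
        ∎

  Δ-absorption : ∀ m (u : ℕ → Carrier) →
                 Δ (suc m) (λ j → fromℕ' j * u j) ≈ - fromℕ' (suc m) * Δ m (λ j → u (suc j))
  Δ-absorption m u = begin
    ±C (suc m) 0 * (0# * u 0)
      + ∑[ j ≤ m ] (±C (suc m) (suc (toℕ j)) * (fromℕ' (suc (toℕ j)) * u (suc (toℕ j))))
      ≈⟨ +-cong (trans (*-congˡ (zeroˡ _)) (zeroʳ _)) (∑-cong (suc m) (λ j → absorb (toℕ j))) ⟩
    0# + ∑[ j ≤ m ] (- fromℕ' (suc m) * (±C m (toℕ j) * u (suc (toℕ j))))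
      ≈⟨ +-identityˡ _ ⟩
    ∑[ j ≤ m ] (- fromℕ' (suc m) * (±C m (toℕ j) * u (suc (toℕ j))))
      ≈⟨ *-distribˡ-sum {suc m} (- fromℕ' (suc m)) (λ j → ±C m (toℕ j) * u (suc (toℕ j))) ⟨
    - fromℕ' (suc m) * Δ m (λ j → u (suc j))
      ∎
    where
    absorb : ∀ j → ±C (suc m) (suc j) * (fromℕ' (suc j) * u (suc j))
                   ≈ - fromℕ' (suc m) * (±C m j * u (suc j))
    absorb j = begin
      - 1# * s * fromℕ' (suc m C suc j) * (fromℕ' (suc j) * u (suc j))
        ≈⟨ solve 4 (λ s c J w → con -[1+ 0 ] :* s :* c :* (J :* w) := con -[1+ 0 ] :* s :* (c :* J) :* w)
                   refl s _ _ _ ⟩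
      - 1# * s * (fromℕ' (suc m C suc j) * fromℕ' (suc j)) * u (suc j)
        ≈⟨ *-congʳ (*-congˡ (C-absorption m j)) ⟩
      - 1# * s * (fromℕ' (suc m) * fromℕ' (m C j)) * u (suc j)
        ≈⟨ solve 4 (λ s M c w → con -[1+ 0 ] :* s :* (M :* c) :* w := :- M :* (s :* c :* w)) refl s _ _ _ ⟩
      - fromℕ' (suc m) * (±C m j * u (suc j))
        ∎
      where s = pow (- 1#) j

  Δ-pow≈0 : ∀ {i m} y → i ℕ.< m → Δ m (λ j → pow (y - fromℕ' j) i) ≈ 0#
  Δ-pow≈0 {zero}  {suc m} y _          = trans (Δ-suc m (λ _ → 1#)) (-‿inverseʳ _)
  Δ-pow≈0 {suc i} {suc m} y (ℕ.s≤s i<m) = begin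
    Δ (suc m) (λ j → (y - fromℕ' j) * p j)
      ≈⟨ Δ-cong (suc m) (λ j _ → solve 3 (λ y J p → (y :- J) :* p := y :* p :+ con -[1+ 0 ] :* (J :* p))
                                         refl y (fromℕ' j) (p j)) ⟩
    Δ (suc m) (λ j → y * p j + - 1# * (fromℕ' j * p j))
      ≈⟨ Δ-linear (suc m) y (- 1#) p (λ j → fromℕ' j * p j) ⟩
    y * Δ (suc m) p + - 1# * Δ (suc m) (λ j → fromℕ' j * p j)
      ≈⟨ +-cong (*-congˡ (Δ-pow≈0 y (ℕ.m≤n⇒m≤1+n i<m))) (*-congˡ (Δ-absorption m p)) ⟩
    y * 0# + - 1# * (- fromℕ' (suc m) * Δ m (λ j → p (suc j)))
      ≈⟨ +-congˡ (*-congˡ (*-congˡ (trans (Δ-cong m (λ j _ → pow-congˡ i (shift j)))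
                                          (Δ-pow≈0 (y - 1#) i<m)))) ⟩
    y * 0# + - 1# * (- fromℕ' (suc m) * 0#)
      ≈⟨ solve 3 (λ y a M → y :* con (+ 0) :+ a :* (:- M :* con (+ 0)) := con (+ 0)) refl y (- 1#) _ ⟩
    0#
      ∎
    where
    p : ℕ → Carrier
    p j = pow (y - fromℕ' j) i
    shift : ∀ j → y - fromℕ' (suc j) ≈ (y - 1#) - fromℕ' j
    shift j = solve 2 (λ y J → y :- (con (+ 1) :+ J) := (y :- con (+ 1)) :- J) refl y (fromℕ' j)

  -- Partial fractions

  -- rising K m = K (K + 1) ⋯ (K + m), written via its top factor as a falling factorial.
  rising : Carrier → ℕ → Carrier
  rising K m = K * fall (fromℕ' m + K) m

  rising-suc-last : ∀ K m → rising K (suc m) ≈ (fromℕ' (suc m) + K) * rising K m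
  rising-suc-last K m = begin
    K * ((1# + M + K) * fall ((1# + M + K) - 1#) m)
      ≈⟨ *-congˡ (*-congˡ (fall-congˡ m
           (solve 2 (λ M K → (con (+ 1) :+ M :+ K) :- con (+ 1) := M :+ K) refl M K))) ⟩
    K * ((1# + M + K) * fall (M + K) m)
      ≈⟨ x∙yz≈y∙xz K _ _ ⟩
    (1# + M + K) * rising K m
      ∎
    where M = fromℕ' m

  rising-suc-first : ∀ K m → rising K (suc m) ≈ K * rising (K + 1#) m
  rising-suc-first K m = *-congˡ (begin
    fall (1# + M + K) (suc m)
      ≈⟨ fall-suc-last (1# + M + K) m ⟩
    fall (1# + M + K) m * ((1# + M + K) - M)
      ≈⟨ *-cong (fall-congˡ m (solve 2 (λ M K → con (+ 1) :+ M :+ K := M :+ (K :+ con (+ 1))) refl M K))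
                (solve 2 (λ M K → (con (+ 1) :+ M :+ K) :- M := K :+ con (+ 1)) refl M K) ⟩
    fall (M + (K + 1#)) m * (K + 1#)
      ≈⟨ *-comm _ _ ⟩
    rising (K + 1#) m
      ∎)
    where M = fromℕ' m

  Reciprocals : ℕ → Carrier → (ℕ → Carrier) → Set ℓ
  Reciprocals m K w = ∀ j → j ≤ m → (K + fromℕ' j) * w j ≈ 1#

  Δ-reciprocals : ∀ m K w → Reciprocals m K w → rising K m * Δ m w ≈ fromℕ' (m !)
  Δ-reciprocals zero K w inv = begin
    K * 1# * (1# * (1# + 0#) * w 0 + 0#)
      ≈⟨ solve 2 (λ K w → K :* con (+ 1) :* (con (+ 1) :* (con (+ 1) :+ con (+ 0)) :* w :+ con (+ 0))
                            := (K :+ con (+ 0)) :* w) refl K (w 0) ⟩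
    (K + 0#) * w 0
      ≈⟨ inv 0 ℕ.z≤n ⟩
    1#
      ≈⟨ +-identityʳ 1# ⟨
    1# + 0#
      ∎
  Δ-reciprocals (suc m) K w inv = begin
    rising K (suc m) * Δ (suc m) w
      ≈⟨ *-congˡ (Δ-suc m w) ⟩
    rising K (suc m) * (Δ m w - Δ m (λ j → w (suc j)))
      ≈⟨ solve 3 (λ q a b → q :* (a :- b) := q :* a :- q :* b) refl _ _ _ ⟩
    rising K (suc m) * Δ m w - rising K (suc m) * Δ m (λ j → w (suc j))
      ≈⟨ +-cong (trans (*-congʳ (rising-suc-last K m)) (*-assoc _ _ _))
                (-‿cong (trans (*-congʳ (rising-suc-first K m)) (*-assoc _ _ _))) ⟩
    (fromℕ' (suc m) + K) * (rising K m * Δ m w) - K * (rising (K + 1#) m * Δ m (λ j → w (suc j)))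
      ≈⟨ +-cong (*-congˡ (Δ-reciprocals m K w (λ j j≤m → inv j (ℕ.m≤n⇒m≤1+n j≤m))))
                (-‿cong (*-congˡ (Δ-reciprocals m (K + 1#) (λ j → w (suc j)) shifted))) ⟩
    (fromℕ' (suc m) + K) * fromℕ' (m !) - K * fromℕ' (m !)
      ≈⟨ solve 3 (λ M K f → (M :+ K) :* f :- K :* f := M :* f) refl _ K _ ⟩
    fromℕ' (suc m) * fromℕ' (m !)
      ≈⟨ fromℕ'-homo-* (suc m) (m !) ⟨
    fromℕ' (suc m !)
      ∎
    where
    shifted : Reciprocals m (K + 1#) (λ j → w (suc j))
    shifted j j≤m =
      trans (*-congʳ (solve 2 (λ K J → K :+ con (+ 1) :+ J := K :+ (con (+ 1) :+ J)) refl K (fromℕ' j)))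
            (inv (suc j) (ℕ.s≤s j≤m))

  Δ-reciprocals-pow : ∀ m K w x i → Reciprocals m K w → i ≤ m →
                      rising K m * Δ m (λ j → w j * pow (x - fromℕ' j) i) ≈ fromℕ' (m !) * pow (x + K) i
  Δ-reciprocals-pow m K w x zero    inv _   = begin
    rising K m * Δ m (λ j → w j * 1#) ≈⟨ *-congˡ (Δ-cong m (λ j _ → *-identityʳ (w j))) ⟩
    rising K m * Δ m w                ≈⟨ Δ-reciprocals m K w inv ⟩
    fromℕ' (m !)                      ≈⟨ *-identityʳ _ ⟨
    fromℕ' (m !) * 1#                 ∎
  Δ-reciprocals-pow m K w x (suc i) inv i<m = begin
    rising K m * Δ m (λ j → w j * ((x - fromℕ' j) * p j))
      ≈⟨ *-congˡ (Δ-cong m split) ⟩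
    rising K m * Δ m (λ j → (x + K) * (w j * p j) + - 1# * p j)
      ≈⟨ *-congˡ (Δ-linear m (x + K) (- 1#) (λ j → w j * p j) p) ⟩
    rising K m * ((x + K) * Δ m (λ j → w j * p j) + - 1# * Δ m p)
      ≈⟨ *-congˡ (+-congˡ (*-congˡ (Δ-pow≈0 x i<m))) ⟩
    rising K m * ((x + K) * Δ m (λ j → w j * p j) + - 1# * 0#)
      ≈⟨ solve 4 (λ r y d a → r :* (y :* d :+ a :* con (+ 0)) := y :* (r :* d)) refl _ (x + K) _ (- 1#) ⟩
    (x + K) * (rising K m * Δ m (λ j → w j * p j))
      ≈⟨ *-congˡ (Δ-reciprocals-pow m K w x i inv (ℕ.<⇒≤ i<m)) ⟩
    (x + K) * (fromℕ' (m !) * pow (x + K) i)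
      ≈⟨ x∙yz≈y∙xz (x + K) _ _ ⟩
    fromℕ' (m !) * pow (x + K) (suc i)
      ∎
    where
    p : ℕ → Carrier
    p j = pow (x - fromℕ' j) i
    split : ∀ j → j ≤ m → w j * ((x - fromℕ' j) * p j) ≈ (x + K) * (w j * p j) + - 1# * p j
    split j j≤m = begin
      w j * ((x - fromℕ' j) * p j)
        ≈⟨ solve 5 (λ w x J K p → w :* ((x :- J) :* p)
                                    := (x :+ K) :* (w :* p) :+ con -[1+ 0 ] :* ((K :+ J) :* w :* p))
                   refl (w j) x (fromℕ' j) K (p j) ⟩
      (x + K) * (w j * p j) + - 1# * ((K + fromℕ' j) * w j * p j)
        ≈⟨ +-congˡ (*-congˡ (trans (*-congʳ (inv j j≤m)) (*-identityˡ (p j)))) ⟩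
      (x + K) * (w j * p j) + - 1# * p j
        ∎

  Δ-reciprocals-poly : ∀ m K w x n (a : Fin (suc n) → Carrier) → Reciprocals m K w → n ≤ m →
                       rising K m * Δ m (λ j → w j * evalPoly n a (x - fromℕ' j))
                         ≈ fromℕ' (m !) * evalPoly n a (x + K)
  Δ-reciprocals-poly m K w x n a inv n≤m = begin
    rising K m * Δ m (λ j → w j * evalPoly n a (x - fromℕ' j))
      ≈⟨ *-congˡ (Δ-cong m (λ j _ → distribute j)) ⟩
    rising K m * Δ m (λ j → ∑[ i ≤ n ] (a i * q i j))
      ≈⟨ *-congˡ (Δ-∑ m (λ i j → a i * q i j)) ⟩
    rising K m * ∑[ i ≤ n ] Δ m (λ j → a i * q i j)
      ≈⟨ *-distribˡ-sum (rising K m) (λ i → Δ m (λ j → a i * q i j)) ⟩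
    ∑[ i ≤ n ] (rising K m * Δ m (λ j → a i * q i j))
      ≈⟨ ∑-cong (suc n) monomial ⟩
    ∑[ i ≤ n ] (fromℕ' (m !) * (a i * pow (x + K) (toℕ i)))
      ≈⟨ *-distribˡ-sum (fromℕ' (m !)) (λ i → a i * pow (x + K) (toℕ i)) ⟨
    fromℕ' (m !) * ∑[ i ≤ n ] (a i * pow (x + K) (toℕ i))
      ≡⟨ ≡.cong (_*_ (fromℕ' (m !))) (sumFin≡sum (suc n) (λ i → a i * pow (x + K) (toℕ i))) ⟨
    fromℕ' (m !) * evalPoly n a (x + K)
      ∎
    where
    q : Fin (suc n) → ℕ → Carrier
    q i j = w j * pow (x - fromℕ' j) (toℕ i)
    distribute : ∀ j → w j * evalPoly n a (x - fromℕ' j) ≈ ∑[ i ≤ n ] (a i * q i j)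
    distribute j = begin
      w j * evalPoly n a (x - fromℕ' j)
        ≡⟨ ≡.cong (_*_ (w j)) (sumFin≡sum (suc n) (λ i → a i * pow (x - fromℕ' j) (toℕ i))) ⟩
      w j * ∑[ i ≤ n ] (a i * pow (x - fromℕ' j) (toℕ i))
        ≈⟨ *-distribˡ-sum (w j) (λ i → a i * pow (x - fromℕ' j) (toℕ i)) ⟩
      ∑[ i ≤ n ] (w j * (a i * pow (x - fromℕ' j) (toℕ i)))
        ≈⟨ ∑-cong (suc n) (λ i → x∙yz≈y∙xz (w j) (a i) (pow (x - fromℕ' j) (toℕ i))) ⟩
      ∑[ i ≤ n ] (a i * q i j)
        ∎
    monomial : ∀ i → rising K m * Δ m (λ j → a i * q i j) ≈ fromℕ' (m !) * (a i * pow (x + K) (toℕ i))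
    monomial i = begin
      rising K m * Δ m (λ j → a i * q i j)
        ≈⟨ *-congˡ (Δ-scale m (a i) (q i)) ⟩
      rising K m * (a i * Δ m (q i))
        ≈⟨ x∙yz≈y∙xz _ (a i) _ ⟩
      a i * (rising K m * Δ m (q i))
        ≈⟨ *-congˡ (Δ-reciprocals-pow m K w x (toℕ i) inv (ℕ.≤-trans (Fin.toℕ≤pred[n] i) n≤m)) ⟩
      a i * (fromℕ' (m !) * pow (x + K) (toℕ i))
        ≈⟨ x∙yz≈y∙xz (a i) _ _ ⟩
      fromℕ' (m !) * (a i * pow (x + K) (toℕ i))
        ∎

module CharZeroFieldProperties {c ℓ : Level} (F : CharZeroField c ℓ) where
  open CharZeroField F
  open CommutativeRingProperties commutativeRing
  open ≈-Reasoning setoid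
  open ℤ-CoefficientSolver using (solve; _:*_; _:=_)
  open import Algebra.Properties.Semiring.Sum semiring using (sum⁺-syntax)
  open import Algebra.Properties.Ring ring using (-‿involutive; -0#≈0#)

  fromℤ≈0⇒≡0 : ∀ z → fromℤ z ≈ 0# → z ≡ + 0
  fromℤ≈0⇒≡0 (+ zero)  _     = ≡.refl
  fromℤ≈0⇒≡0 (+ suc n) n+1≈0 = contradiction n+1≈0 (charZero n)
  fromℤ≈0⇒≡0 -[1+ n ]  -n-1≈0 =
    contradiction (trans (sym (-‿involutive _)) (trans (-‿cong -n-1≈0) -0#≈0#)) (charZero n)

  fromℕ'-inverse : ∀ n → .{{ℕ.NonZero n}} → fromℕ' n * fromℕ' n ⁻¹ ≈ 1#
  fromℕ'-inverse (suc n) = inverse _ (charZero n)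

  !-inverse : ∀ n → fromℕ' (n !) * fromℕ' (n !) ⁻¹ ≈ 1#
  !-inverse n = fromℕ'-inverse (n !) {{n ℕ.!≢0}}

  binom≈C : ∀ m j → binom (+ m) j ≈ fromℕ' (m C j)
  binom≈C m j = begin
    falling (+ m) j * fromℕ' (j !) ⁻¹                  ≈⟨ *-congʳ (falling≈fall (+ m) j) ⟩
    fall (fromℕ' m) j * fromℕ' (j !) ⁻¹                ≈⟨ *-congʳ (C-falling m j) ⟨
    fromℕ' (m C j) * fromℕ' (j !) * fromℕ' (j !) ⁻¹    ≈⟨ *-assoc _ _ _ ⟩
    fromℕ' (m C j) * (fromℕ' (j !) * fromℕ' (j !) ⁻¹)  ≈⟨ *-congˡ (!-inverse j) ⟩
    fromℕ' (m C j) * 1#                                ≈⟨ *-identityʳ _ ⟩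
    fromℕ' (m C j)                                     ∎

  fromℤ*binom≈rising : ∀ m k →
                       fromℤ k * binom (+ m ℤ.+ k) m ≈ rising (fromℤ k) m * fromℕ' (m !) ⁻¹
  fromℤ*binom≈rising m k = begin
    fromℤ k * (falling (+ m ℤ.+ k) m * fromℕ' (m !) ⁻¹)
      ≈⟨ *-assoc _ _ _ ⟨
    fromℤ k * falling (+ m ℤ.+ k) m * fromℕ' (m !) ⁻¹
      ≈⟨ *-congʳ (*-congˡ (falling≈fall (+ m ℤ.+ k) m)) ⟩
    fromℤ k * fall (fromℤ (+ m ℤ.+ k)) m * fromℕ' (m !) ⁻¹
      ≈⟨ *-congʳ (*-congˡ (fall-congˡ m (fromℤ-homo-+ (+ m) k))) ⟩
    rising (fromℤ k) m * fromℕ' (m !) ⁻¹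
      ∎

  ∑-binom≈Δ : ∀ m (w u : ℕ → Carrier) →
              sumFin (suc m) (λ j → pow (- 1#) (toℕ j) * w (toℕ j) * binom (+ m) (toℕ j) * u (toℕ j))
                ≈ Δ m (λ j → w j * u j)
  ∑-binom≈Δ m w u = begin
    sumFin (suc m) (λ j → t (toℕ j))  ≡⟨ sumFin≡sum (suc m) (λ j → t (toℕ j)) ⟩
    ∑[ j ≤ m ] t (toℕ j)              ≈⟨ ∑-cong (suc m) (λ j → reorder (toℕ j)) ⟩
    Δ m (λ j → w j * u j)             ∎
    where
    t : ℕ → Carrier
    t j = pow (- 1#) j * w j * binom (+ m) j * u j
    reorder : ∀ j → t j ≈ ±C m j * (w j * u j)
    reorder j = trans (*-congʳ (*-congˡ (binom≈C m j)))
                      (solve 4 (λ s w c u → s :* w :* c :* u := s :* c :* (w :* u))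
                               refl (pow (- 1#) j) (w j) _ (u j))

  reciprocals : ∀ m k → ¬ ((ℤ.- (+ m) ℤ.≤ k) × (k ℤ.≤ + 0)) →
                Reciprocals m (fromℤ k) (λ j → fromℤ (k ℤ.+ + j) ⁻¹)
  reciprocals m k k∉[-m,0] j j≤m = begin
    (fromℤ k + fromℕ' j) * fromℤ (k ℤ.+ + j) ⁻¹  ≈⟨ *-congʳ (fromℤ-homo-+ k (+ j)) ⟨
    fromℤ (k ℤ.+ + j) * fromℤ (k ℤ.+ + j) ⁻¹     ≈⟨ inverse _ (k∉[-m,0] ∘ k∈[-m,0] ∘ fromℤ≈0⇒≡0 _) ⟩
    1#                                           ∎
    where
    k∈[-m,0] : k ℤ.+ + j ≡ + 0 → (ℤ.- (+ m) ℤ.≤ k) × (k ℤ.≤ + 0)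
    k∈[-m,0] k+j≡0
      rewrite ℤ.i-j≡0⇒i≡j k (ℤ.- + j) (≡.trans (≡.cong (ℤ._+_ k) (ℤ.neg-involutive (+ j))) k+j≡0) =
      ℤ.neg-mono-≤ (ℤ.+≤+ j≤m) , ℤ.neg-mono-≤ (ℤ.+≤+ ℕ.z≤n)

theorem8p9 : ∀ {c ℓ : Level} (F : CharZeroField c ℓ) → let open CharZeroField F in
    (m n : ℕ) → n ≤ m →
    (a : Fin (suc n) → Carrier) → ¬ (a (fromℕ n) ≈ 0#) →
    (k : ℤ) → ¬ ((ℤ.- (+ m) ℤ.≤ k) × (k ℤ.≤ + 0)) →
    (x : Carrier) →
      evalPoly n a (x + fromℤ k)
        ≈ fromℤ k * binom (+ m ℤ.+ k) m
            * sumFin (suc m) (λ j →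
                pow (- 1#) (toℕ j) * (fromℤ (k ℤ.+ + toℕ j) ⁻¹)
                  * binom (+ m) (toℕ j) * evalPoly n a (x - fromℕ' (toℕ j)))
-- The identity holds for every polynomial of degree at most m, so the
-- hypothesis on the leading coefficient is not needed.
theorem8p9 F m n n≤m a _ k k∉[-m,0] x = sym (begin
  fromℤ k * binom (+ m ℤ.+ k) m
    * sumFin (suc m) (λ j → pow (- 1#) (toℕ j) * w (toℕ j) * binom (+ m) (toℕ j) * f (toℕ j))
    ≈⟨ *-cong (fromℤ*binom≈rising m k) (∑-binom≈Δ m w f) ⟩
  rising K m * m!⁻¹ * Δ m (λ j → w j * f j)
    ≈⟨ solve 3 (λ r i d → r :* i :* d := i :* (r :* d)) refl _ _ _ ⟩
  m!⁻¹ * (rising K m * Δ m (λ j → w j * f j))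
    ≈⟨ *-congˡ (Δ-reciprocals-poly m K w x n a (reciprocals m k k∉[-m,0]) n≤m) ⟩
  m!⁻¹ * (fromℕ' (m !) * evalPoly n a (x + K))
    ≈⟨ solve 3 (λ i M e → i :* (M :* e) := M :* i :* e) refl _ _ _ ⟩
  fromℕ' (m !) * m!⁻¹ * evalPoly n a (x + K)
    ≈⟨ trans (*-congʳ (!-inverse m)) (*-identityˡ _) ⟩
  evalPoly n a (x + K)
    ∎)
  where
  open CharZeroField F
  open CommutativeRingProperties commutativeRing
  open CharZeroFieldProperties F
  open ℤ-CoefficientSolver using (solve; _:*_; _:=_)
  open ≈-Reasoning setoid
  K m!⁻¹ : Carrier
  K    = fromℤ k
  m!⁻¹ = fromℕ' (m !) ⁻¹
  w f : ℕ → Carrier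
  w j = fromℤ (k ℤ.+ + j) ⁻¹
  f j = evalPoly n a (x - fromℕ' j)
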